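{- For every odd integer $k\geq 3$, the graph $J_k$ has a Fulkerson covering.
   Context: For odd $k\geq 3$, $J_k$ is the cubic graph on the $4k$ vertices $x_0,\dots,x_{k-1}$, $y_0,\dots,y_{k-1}$, $z_0,\dots,z_{k-1}$, $t_0,\dots,t_{k-1}$ whose edges are: the edges of the cycle $x_0x_1\cdots x_{k-1}x_0$ (length $k$), the edges of the cycle $y_0y_1\cdots y_{k-1}z_0z_1\cdots z_{k-1}y_0$ (length $2k$), and for each $i=0,\dots,k-1$ the three edges $t_ix_i$, $t_iy_i$, $t_iz_i$. A Fulkerson covering of a graph $G$ is a family of $6$ perfect matchings $M_1,\dots,M_6$ of $G$ (not necessarily distinct) such that every edge of $G$ lies in exactly two of them. -}

module Defs where

open import Data.Nat using (ℕ; suc; _≥_; _+_; _*_)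
import Data.Nat as ℕ
open import Data.Fin using (Fin; zero; suc; toℕ; fromℕ<)
open import Data.Fin.Properties using ()
open import Data.Bool using (Bool; true; false)
open import Data.Product using (_×_; _,_; Σ; ∃; ∃-syntax)
open import Data.Sum using (_⊎_)
open import Data.List using (List; length; filter)
open import Data.List using (allFin)
open import Data.Bool using (T)
open import Relation.Binary.PropositionalEquality using (_≡_)
open import Data.Nat.DivMod using (_mod_)

data VKind : Set where
  vx vy vz vt : VKind

Vertex : ℕ → Set
Vertex k = VKind × Fin k

-- Edges of J_k, one constructor-family per type of edge, indexed by i ∈ Fin k:
--   ex i : x_i x_{i+1 mod k}                      (the k-cycle on the x's)
--   ey i : y_i y_{i+1}  (i < k-1),  y_{k-1} z_0   (first half of the 2k-cycle)
--   ez i : z_i z_{i+1}  (i < k-1),  z_{k-1} y_0   (second half of the 2k-cycle)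
--   etx i, ety i, etz i : t_i x_i, t_i y_i, t_i z_i
data EKind : Set where
  ex ey ez etx ety etz : EKind

Edge : ℕ → Set
Edge k = EKind × Fin k

sucMod : ∀ {k} → Fin k → Fin k
sucMod {suc k} i = (suc (toℕ i)) mod (suc k)

isLast : ∀ {k} → Fin k → Bool
isLast {suc ℕ.zero} zero = true
isLast {suc (suc k)} zero = false
isLast {suc (suc k)} (suc i) = isLast {suc k} i

nextYZ : ∀ {k} → VKind → Fin k → VKind
nextYZ vy i with isLast i
... | true  = vz
... | false = vy
nextYZ vz i with isLast i
... | true  = vy
... | false = vz
nextYZ v i = v

ends : ∀ {k} → Edge k → Vertex k × Vertex k
ends (ex , i)  = (vx , i) , (vx , sucMod i)
ends (ey , i)  = (vy , i) , (nextYZ vy i , sucMod i)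
ends (ez , i)  = (vz , i) , (nextYZ vz i , sucMod i)
ends (etx , i) = (vt , i) , (vx , i)
ends (ety , i) = (vt , i) , (vy , i)
ends (etz , i) = (vt , i) , (vz , i)

Incident : ∀ {k} → Edge k → Vertex k → Set
Incident e v = let (a , b) = ends e in (a ≡ v) ⊎ (b ≡ v)

IsPerfectMatching : ∀ k → (Edge k → Bool) → Set
IsPerfectMatching k M =
  (v : Vertex k) → ∃[ e ] (M e ≡ true × Incident e v ×
     ((e' : Edge k) → M e' ≡ true → Incident e' v → e' ≡ e))

countIn : ∀ {k} → (Fin 6 → Edge k → Bool) → Edge k → ℕ
countIn M e = length (filter (λ j → Data.Bool._≟_ (M j e) true) (allFin 6))
  where import Data.Bool

HasFulkersonCovering : ℕ → Set
HasFulkersonCovering k =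
  Σ (Fin 6 → Edge k → Bool) λ M →
    ((j : Fin 6) → IsPerfectMatching k (M j)) ×
    ((e : Edge k) → countIn M e ≡ 2)

Odd : ℕ → Set
Odd k = ∃[ m ] (k ≡ 2 * m + 1)

-- Call index 0 initial, index k-1 final, and the other indices odd or even by parity.
-- As k is odd, index k-2 is odd, so consecutive indices (i-1, i) follow one of only five
-- patterns: final-initial, initial-odd, odd-even, even-odd, odd-final. Six matchings are
-- described by assigning to every edge the pair of them containing it, and this pair depends
-- only on the kind of the edge and the type of its index. The three edges at x_i, y_i, z_i
-- or t_i live at indices i-1 and i, so the perfect-matching condition there (the three pairs
-- partition the six matchings) depends only on the pattern of (i-1, i): a finite check.

module Submission where

open import Defs
open import Data.Nat using (ℕ; zero; suc; _+_; _*_; _≥_; s≤s)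
open import Data.Nat.Properties using (*-suc; +-comm)
open import Data.Nat.DivMod using (_%_; n%n≡0; m<n⇒m%n≡m)
open import Data.Fin using (Fin; zero; suc; toℕ; fromℕ; inject₁)
open import Data.Fin.Properties using (toℕ-injective; toℕ-fromℕ<; toℕ-fromℕ; toℕ-inject₁; toℕ<n; all?; _≟_)
open import Data.Fin.Patterns
open import Data.Bool using (Bool; true; false; _∨_; if_then_else_)
import Data.Bool.Properties as Bool
open import Data.List using (length; filter; allFin)
open import Data.Unit using (tt)
open import Data.Product using (_×_; _,_; proj₁; proj₂; ∃-syntax)
open import Data.Sum using (_⊎_; inj₁; inj₂)
open import Relation.Nullary using (Dec; yes; no; does)
open import Relation.Nullary.Decidable using (True; toWitness)
open import Relation.Binary.PropositionalEquality

Triple : Set → Set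
Triple A = A × A × A

_∈₃_ : ∀ {A : Set} → A → Triple A → Set
x ∈₃ (a , b , c) = x ≡ a ⊎ x ≡ b ⊎ x ≡ c

pattern 1st = inj₁ refl
pattern 2nd = inj₂ (inj₁ refl)
pattern 3rd = inj₂ (inj₂ refl)

data ExactlyOne : Bool → Bool → Bool → Set where
  first  : ExactlyOne true false false
  second : ExactlyOne false true false
  third  : ExactlyOne false false true

exactlyOne? : ∀ a b c → Dec (ExactlyOne a b c)
exactlyOne? true  false false = yes first
exactlyOne? false true  false = yes second
exactlyOne? false false true  = yes third
exactlyOne? true  true  _     = no λ ()
exactlyOne? true  false true  = no λ ()
exactlyOne? false true  true  = no λ ()
exactlyOne? false false false = no λ ()

module _ {A : Set} (P : A → Bool) where

  ExactlyOneOf : Triple A → Set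
  ExactlyOneOf (a , b , c) = ExactlyOne (P a) (P b) (P c)

  private
    clash : ∀ {x} {B : Set} → P x ≡ true → P x ≡ false → B
    clash px≡true px≡false with () ← trans (sym px≡true) px≡false

  exactlyOneOf⇒unique : ∀ t → ExactlyOneOf t →
    ∃[ x ] (P x ≡ true × x ∈₃ t × (∀ y → P y ≡ true → y ∈₃ t → y ≡ x))
  exactlyOneOf⇒unique (a , b , c) one with P a in pa | P b in pb | P c in pc | one
  ... | _ | _ | _ | first  = a , pa , 1st , λ where
    _ _  1st → refl
    _ py 2nd → clash py pb
    _ py 3rd → clash py pc
  ... | _ | _ | _ | second = b , pb , 2nd , λ where
    _ py 1st → clash py pa
    _ _  2nd → refl
    _ py 3rd → clash py pc
  ... | _ | _ | _ | third  = c , pc , 3rd , λ where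
    _ py 1st → clash py pa
    _ py 2nd → clash py pb
    _ _  3rd → refl

data LastView {n : ℕ} : Fin (suc n) → Set where
  last    : LastView (fromℕ n)
  notLast : (j : Fin n) → LastView (inject₁ j)

lastView : ∀ {n} (i : Fin (suc n)) → LastView i
lastView {zero}  zero    = last
lastView {suc n} zero    = notLast zero
lastView {suc n} (suc i) with lastView i
... | last      = last
... | notLast j = notLast (suc j)

isLast-fromℕ : ∀ n → isLast (fromℕ n) ≡ true
isLast-fromℕ zero    = refl
isLast-fromℕ (suc n) = isLast-fromℕ n

isLast-inject₁ : ∀ {n} (j : Fin n) → isLast (inject₁ j) ≡ false
isLast-inject₁ {suc n} zero    = refl
isLast-inject₁ {suc n} (suc j) = isLast-inject₁ j

toℕ-sucMod : ∀ {n} (i : Fin (suc n)) → toℕ (sucMod i) ≡ suc (toℕ i) % suc n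
toℕ-sucMod i = toℕ-fromℕ< _

sucMod-fromℕ : ∀ n → sucMod (fromℕ n) ≡ zero
sucMod-fromℕ n = toℕ-injective (begin
  toℕ (sucMod (fromℕ n))       ≡⟨ toℕ-sucMod (fromℕ n) ⟩
  suc (toℕ (fromℕ n)) % suc n  ≡⟨ cong (λ t → suc t % suc n) (toℕ-fromℕ n) ⟩
  suc n % suc n                ≡⟨ n%n≡0 (suc n) ⟩
  0                            ∎)
  where open ≡-Reasoning

sucMod-inject₁ : ∀ {n} (j : Fin n) → sucMod (inject₁ j) ≡ suc j
sucMod-inject₁ {n} j = toℕ-injective (begin
  toℕ (sucMod (inject₁ j))       ≡⟨ toℕ-sucMod (inject₁ j) ⟩
  suc (toℕ (inject₁ j)) % suc n  ≡⟨ cong (λ t → suc t % suc n) (toℕ-inject₁ j) ⟩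
  suc (toℕ j) % suc n            ≡⟨ m<n⇒m%n≡m (s≤s (toℕ<n j)) ⟩
  suc (toℕ j)                    ∎)
  where open ≡-Reasoning

predMod : ∀ {n} → Fin (suc n) → Fin (suc n)
predMod {n} zero = fromℕ n
predMod (suc j)  = inject₁ j

sucMod-predMod : ∀ {n} (i : Fin (suc n)) → sucMod (predMod i) ≡ i
sucMod-predMod {n} zero = sucMod-fromℕ n
sucMod-predMod (suc j)  = sucMod-inject₁ j

-- The kind of the edge of the 2k-cycle arriving at y_i (resp. z_i) from index i - 1;
-- at i = 0 the cycle crosses over: z_{k-1} y_0 has kind ez and y_{k-1} z_0 has kind ey.
intoY intoZ : ∀ {n} → Fin (suc n) → EKind
intoY zero    = ez
intoY (suc _) = ey
intoZ zero    = ey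
intoZ (suc _) = ez

star : ∀ {n} → Vertex (suc n) → Triple (Edge (suc n))
star (vt , i) = (etx , i) , (ety , i) , (etz , i)
star (vx , i) = (etx , i) , (ex , i) , (ex , predMod i)
star (vy , i) = (ety , i) , (ey , i) , (intoY i , predMod i)
star (vz , i) = (etz , i) , (ez , i) , (intoZ i , predMod i)

∈star-fst : ∀ {n} (e : Edge (suc n)) → e ∈₃ star (proj₁ (ends e))
∈star-fst (ex  , _) = 2nd
∈star-fst (ey  , _) = 2nd
∈star-fst (ez  , _) = 2nd
∈star-fst (etx , _) = 1st
∈star-fst (ety , _) = 2nd
∈star-fst (etz , _) = 3rd

∈star-snd : ∀ {n} (e : Edge (suc n)) → e ∈₃ star (proj₂ (ends e))
∈star-snd (etx , _) = 1st
∈star-snd (ety , _) = 1st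
∈star-snd (etz , _) = 1st
∈star-snd {n} (ex , j) with lastView j
... | last      rewrite sucMod-fromℕ n = 3rd
... | notLast i rewrite sucMod-inject₁ i = 3rd
∈star-snd {n} (ey , j) with lastView j
... | last      rewrite isLast-fromℕ n | sucMod-fromℕ n = 3rd
... | notLast i rewrite isLast-inject₁ i | sucMod-inject₁ i = 3rd
∈star-snd {n} (ez , j) with lastView j
... | last      rewrite isLast-fromℕ n | sucMod-fromℕ n = 3rd
... | notLast i rewrite isLast-inject₁ i | sucMod-inject₁ i = 3rd

incident⇒∈star : ∀ {n} (e : Edge (suc n)) {v} → Incident e v → e ∈₃ star v
incident⇒∈star e (inj₁ refl) = ∈star-fst e
incident⇒∈star e (inj₂ refl) = ∈star-snd e

arrives-y : ∀ {n} (i : Fin (suc n)) → proj₂ (ends (intoY i , predMod i)) ≡ (vy , i)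
arrives-y {n} zero rewrite isLast-fromℕ n | sucMod-fromℕ n = refl
arrives-y (suc j) rewrite isLast-inject₁ j | sucMod-inject₁ j = refl

arrives-z : ∀ {n} (i : Fin (suc n)) → proj₂ (ends (intoZ i , predMod i)) ≡ (vz , i)
arrives-z {n} zero rewrite isLast-fromℕ n | sucMod-fromℕ n = refl
arrives-z (suc j) rewrite isLast-inject₁ j | sucMod-inject₁ j = refl

∈star⇒incident : ∀ {n} (v : Vertex (suc n)) {e} → e ∈₃ star v → Incident e v
∈star⇒incident (vt , i) 1st = inj₁ refl
∈star⇒incident (vt , i) 2nd = inj₁ refl
∈star⇒incident (vt , i) 3rd = inj₁ refl
∈star⇒incident (vx , i) 1st = inj₂ refl
∈star⇒incident (vx , i) 2nd = inj₁ refl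
∈star⇒incident (vx , i) 3rd = inj₂ (cong (vx ,_) (sucMod-predMod i))
∈star⇒incident (vy , i) 1st = inj₂ refl
∈star⇒incident (vy , i) 2nd = inj₁ refl
∈star⇒incident (vy , i) 3rd = inj₂ (arrives-y i)
∈star⇒incident (vz , i) 1st = inj₂ refl
∈star⇒incident (vz , i) 2nd = inj₁ refl
∈star⇒incident (vz , i) 3rd = inj₂ (arrives-z i)

isPerfectMatching-fromStars : ∀ {n} (M : Edge (suc n) → Bool) →
                              (∀ v → ExactlyOneOf M (star v)) → IsPerfectMatching (suc n) M
isPerfectMatching-fromStars M one v with exactlyOneOf⇒unique M (star v) (one v)
... | e , Me , e∈star , unique =
  e , Me , ∈star⇒incident v e∈star , λ e′ Me′ e′~v → unique e′ Me′ (incident⇒∈star e′ e′~v)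

data IndexType : Set where
  initial odd even final : IndexType

alternating : ℕ → IndexType
alternating zero          = odd
alternating (suc zero)    = even
alternating (suc (suc t)) = alternating t

interior : ℕ → IndexType
interior zero    = initial
interior (suc t) = alternating t

indexType : ∀ {k} → Fin k → IndexType
indexType i = if isLast i then final else interior (toℕ i)

data _⟶_ : IndexType → IndexType → Set where
  final⟶initial : final ⟶ initial
  initial⟶odd   : initial ⟶ odd
  odd⟶even      : odd ⟶ even
  even⟶odd      : even ⟶ odd
  odd⟶final     : odd ⟶ final

alternating-step : ∀ t → alternating t ⟶ alternating (suc t)
alternating-step zero          = odd⟶even
alternating-step (suc zero)    = even⟶odd
alternating-step (suc (suc t)) = alternating-step t

interior-step : ∀ t → interior t ⟶ interior (suc t)
interior-step zero    = initial⟶odd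
interior-step (suc t) = alternating-step t

alternating-even : ∀ m → alternating (2 * m) ≡ odd
alternating-even zero = refl
alternating-even (suc m) rewrite *-suc 2 m = alternating-even m

indexType-step-interior : ∀ m (j : Fin (2 + 2 * m)) → interior (toℕ j) ⟶ indexType (suc j)
indexType-step-interior m j with lastView j
... | last rewrite isLast-fromℕ (1 + 2 * m) =
  subst (_⟶ final) (sym (trans (cong alternating (toℕ-fromℕ (2 * m))) (alternating-even m))) odd⟶final
... | notLast i rewrite isLast-inject₁ i = interior-step (toℕ (inject₁ i))

indexType-step : ∀ m (i : Fin (3 + 2 * m)) → indexType i ⟶ indexType (sucMod i)
indexType-step m i with lastView i
... | last rewrite isLast-fromℕ (2 + 2 * m) | sucMod-fromℕ (2 + 2 * m) = final⟶initial
... | notLast j rewrite isLast-inject₁ j | sucMod-inject₁ j | toℕ-inject₁ j =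
  indexType-step-interior m j

isFinal : IndexType → Bool
isFinal final = true
isFinal _     = false

isFinal-alternating : ∀ t → isFinal (alternating t) ≡ false
isFinal-alternating zero          = refl
isFinal-alternating (suc zero)    = refl
isFinal-alternating (suc (suc t)) = isFinal-alternating t

isFinal-interior : ∀ t → isFinal (interior t) ≡ false
isFinal-interior zero    = refl
isFinal-interior (suc t) = isFinal-alternating t

towardsY towardsZ : IndexType → EKind
towardsY p = if isFinal p then ez else ey
towardsZ p = if isFinal p then ey else ez

intoY-towardsY : ∀ {n} (i : Fin (suc n)) → intoY i ≡ towardsY (indexType (predMod i))
intoY-towardsY {n} zero rewrite isLast-fromℕ n = refl
intoY-towardsY (suc j) rewrite isLast-inject₁ j | isFinal-interior (toℕ (inject₁ j)) = refl

intoZ-towardsZ : ∀ {n} (i : Fin (suc n)) → intoZ i ≡ towardsZ (indexType (predMod i))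
intoZ-towardsZ {n} zero rewrite isLast-fromℕ n = refl
intoZ-towardsZ (suc j) rewrite isLast-inject₁ j | isFinal-interior (toℕ (inject₁ j)) = refl

ColourPair : Set
ColourPair = Fin 6 × Fin 6

_∈ᶜ_ : Fin 6 → ColourPair → Bool
j ∈ᶜ (a , b) = does (j ≟ a) ∨ does (j ≟ b)

∣_∣ᶜ : ColourPair → ℕ
∣ c ∣ᶜ = length (filter (λ j → (j ∈ᶜ c) Bool.≟ true) (allFin 6))

colours : IndexType → EKind → ColourPair
colours initial ex  = 4F , 5F
colours initial ey  = 2F , 3F
colours initial ez  = 0F , 1F
colours initial etx = 1F , 3F
colours initial ety = 0F , 5F
colours initial etz = 2F , 4F
colours odd     ex  = 1F , 3F
colours odd     ey  = 0F , 4F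
colours odd     ez  = 2F , 5F
colours odd     etx = 0F , 2F
colours odd     ety = 1F , 5F
colours odd     etz = 3F , 4F
colours even    ex  = 4F , 5F
colours even    ey  = 2F , 3F
colours even    ez  = 0F , 1F
colours even    etx = 0F , 2F
colours even    ety = 1F , 5F
colours even    etz = 3F , 4F
colours final   ex  = 0F , 2F
colours final   ey  = 3F , 5F
colours final   ez  = 1F , 4F
colours final   etx = 4F , 5F
colours final   ety = 1F , 2F
colours final   etz = 0F , 3F

colours-size : ∀ s K → ∣ colours s K ∣ᶜ ≡ 2
colours-size initial = λ { ex → refl ; ey → refl ; ez → refl ; etx → refl ; ety → refl ; etz → refl }
colours-size odd     = λ { ex → refl ; ey → refl ; ez → refl ; etx → refl ; ety → refl ; etz → refl }
colours-size even    = λ { ex → refl ; ey → refl ; ez → refl ; etx → refl ; ety → refl ; etz → refl }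
colours-size final   = λ { ex → refl ; ey → refl ; ez → refl ; etx → refl ; ety → refl ; etz → refl }

Partition : Triple ColourPair → Set
Partition t = ∀ j → ExactlyOneOf (j ∈ᶜ_) t

partition? : ∀ t → Dec (Partition t)
partition? (p , q , r) = all? λ j → exactlyOne? (j ∈ᶜ p) (j ∈ᶜ q) (j ∈ᶜ r)

starColours : IndexType → IndexType → VKind → Triple ColourPair
starColours p s vt = colours s etx , colours s ety , colours s etz
starColours p s vx = colours s etx , colours s ex  , colours p ex
starColours p s vy = colours s ety , colours s ey  , colours p (towardsY p)
starColours p s vz = colours s etz , colours s ez  , colours p (towardsZ p)

local-partition : ∀ {p s} → p ⟶ s → ∀ V → Partition (starColours p s V)
local-partition t V = toWitness (checked t V)
  where
  checked : ∀ {p s} → p ⟶ s → ∀ V → True (partition? (starColours p s V))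
  checked final⟶initial = λ { vt → tt ; vx → tt ; vy → tt ; vz → tt }
  checked initial⟶odd   = λ { vt → tt ; vx → tt ; vy → tt ; vz → tt }
  checked odd⟶even      = λ { vt → tt ; vx → tt ; vy → tt ; vz → tt }
  checked even⟶odd      = λ { vt → tt ; vx → tt ; vy → tt ; vz → tt }
  checked odd⟶final     = λ { vt → tt ; vx → tt ; vy → tt ; vz → tt }

map₃ : ∀ {A B : Set} → (A → B) → Triple A → Triple B
map₃ f (a , b , c) = f a , f b , f c

colourOf : ∀ {k} → Edge k → ColourPair
colourOf (K , i) = colours (indexType i) K

colours-star : ∀ {n} V (i : Fin (suc n)) →
               map₃ colourOf (star (V , i)) ≡ starColours (indexType (predMod i)) (indexType i) V
colours-star vt i = refl
colours-star vx i = refl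
colours-star vy i rewrite intoY-towardsY i = refl
colours-star vz i rewrite intoZ-towardsZ i = refl

matching : ∀ {k} → Fin 6 → Edge k → Bool
matching j e = j ∈ᶜ colourOf e

matching-perfect : ∀ m j → IsPerfectMatching (3 + 2 * m) (matching j)
matching-perfect m j = isPerfectMatching-fromStars (matching j) λ (V , i) →
  subst (λ t → ExactlyOneOf (j ∈ᶜ_) t) (sym (colours-star V i))
        (local-partition (step-into i) V j)
  where
  step-into : (i : Fin (3 + 2 * m)) → indexType (predMod i) ⟶ indexType i
  step-into i = subst (λ i′ → indexType (predMod i) ⟶ indexType i′) (sucMod-predMod i)
                      (indexType-step m (predMod i))

fulkersonCovering : ∀ m → HasFulkersonCovering (3 + 2 * m)
fulkersonCovering m = matching , matching-perfect m , λ (K , i) → colours-size (indexType i) K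

theorem3p1 : (k : ℕ) → Odd k → k ≥ 3 → HasFulkersonCovering k
theorem3p1 _ (zero , refl) (s≤s ())
theorem3p1 _ (suc m , refl) _ = subst HasFulkersonCovering (sym 2[1+m]+1≡3+2m) (fulkersonCovering m)
  where
  2[1+m]+1≡3+2m : 2 * suc m + 1 ≡ 3 + 2 * m
  2[1+m]+1≡3+2m = trans (cong (_+ 1) (*-suc 2 m)) (+-comm (2 + 2 * m) 1)
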